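{- There exist a HyperLTL sentence $\varphi$ and a transition system $\mathfrak{T}$ such that $\mathfrak{T}\models\varphi$ holds but is not witnessed by computable Skolem functions.
   Context: Fix a finite set $\mathrm{AP}$ of atomic propositions. A transition system $\mathfrak{T}=(V,E,v_I,\lambda)$ has a finite vertex set $V$, edges $E\subseteq V\times V$ such that every vertex has at least one successor, an initial vertex $v_I$, and a labelling $\lambda\colon V\to 2^{\mathrm{AP}}$. A path is an infinite sequence $v_0v_1\cdots$ with $v_0=v_I$ and $(v_n,v_{n+1})\in E$; its trace is $\lambda(v_0)\lambda(v_1)\cdots$, and $\mathrm{Tr}(\mathfrak{T})$ is the set of traces of paths. HyperLTL formulas are given by $\varphi ::= \exists\pi.\,\varphi \mid \forall\pi.\,\varphi\mid\psi$ and $\psi ::= a_\pi\mid\neg\psi\mid\psi\vee\psi\mid\mathbf{X}\psi\mid\psi\,\mathbf{U}\,\psi$ with $a\in\mathrm{AP}$ and $\pi$ a trace variable; a sentence has no free variables. They are evaluated over a set $T$ of traces and a trace assignment $\Pi$ (partial map from variables to $(2^{\mathrm{AP}})^\omega$): $a_\pi$ holds iff $a\in\Pi(\pi)(0)$; Boolean connectives as usual; $\mathbf{X}\psi$ holds iff $\psi$ holds for the assignment shifting every trace by one position; $\psi_1\mathbf{U}\psi_2$ holds iff there is $j\ge0$ with $\psi_2$ holding at the $j$-shifted assignment and $\psi_1$ at all $j'$-shifted assignments for $j'<j$; $\exists\pi.\varphi$ ($\forall\pi.\varphi$) holds iff for some (all) $t\in T$, $\varphi$ holds with $\pi$ mapped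 to $t$. $\mathfrak{T}\models\varphi$ iff $\mathrm{Tr}(\mathfrak{T})$ satisfies $\varphi$ under the empty assignment. Skolem functions: let $\varphi=Q_0\pi_0\cdots Q_{k-1}\pi_{k-1}.\,\psi$ with $\psi$ quantifier-free. For each $i$ with $Q_i=\exists$ let $U_i=\{j<i\mid Q_j=\forall\}=\{i_0<\cdots<i_{|U_i|-1}\}$ and let $f_i\colon \mathrm{Tr}(\mathfrak{T})^{|U_i|}\to\mathrm{Tr}(\mathfrak{T})$. An assignment $\Pi$ is consistent with the $f_i$ if $\Pi(\pi_i)\in\mathrm{Tr}(\mathfrak{T})$ whenever $Q_i=\forall$, and $\Pi(\pi_i)=f_i(\Pi(\pi_{i_0}),\ldots,\Pi(\pi_{i_{|U_i|-1}}))$ whenever $Q_i=\exists$. The $f_i$ are Skolem functions witnessing $\mathfrak{T}\models\varphi$ if every consistent $\Pi$ satisfies $\psi$. Computability: a partial function $g\colon\Sigma^\omega\to\Gamma^\omega$ is computable if a deterministic Turing machine with a one-way read-only input tape, a two-way work tape and a one-way write-only output tape, started on any $w\in\mathrm{dom}(g)$, produces in the limit $g(w)$ on the output tape (behaviour outside the domain is arbitrary). A function of $n$ traces is treated as a function on merged words $\langle w_0,\ldots,w_{n-1}\rangle=(w_0(0),\ldots,w_{n-1}(0))(w_0(1),\ldots,w_{n-1}(1))\cdots\in((2^{\mathrm{AP}})^n)^\omega$. Skolem functions are computable if each $f_i$ is computable in this sense. -}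

module Defs where

open import Level using (0ℓ)
open import Data.Nat using (ℕ; zero; suc; _+_; _<_)
open import Data.Nat.Properties using () renaming (_≟_ to _≟ℕ_)
open import Data.Integer using (ℤ) renaming (_+_ to _+ℤ_; _-_ to _-ℤ_)
open import Data.Integer.Properties using () renaming (_≟_ to _≟ℤ_)
open import Data.Fin using (Fin)
open import Data.Bool using (Bool; true; false; if_then_else_)
open import Data.Maybe using (Maybe; just; nothing)
open import Data.Vec using (Vec; []; _∷ʳ_; lookup; map)
open import Data.Vec.Relation.Unary.All using (All)
open import Data.Product using (Σ; _×_; _,_)
open import Data.Sum using (_⊎_)
open import Data.Unit using (⊤)
open import Relation.Nullary using (¬_; yes; no)
open import Relation.Binary.PropositionalEquality using (_≡_)

-- Atomic propositions: AP = Fin n.  A letter is a subset of AP,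
-- represented as its characteristic vector.

Letter : ℕ → Set
Letter n = Vec Bool n

_∈ₗ_ : {n : ℕ} → Fin n → Letter n → Set
a ∈ₗ ℓ = lookup ℓ a ≡ true

Trace : ℕ → Set
Trace n = ℕ → Letter n

record TS (n : ℕ) : Set where
  field
    size  : ℕ
    edge  : Fin size → Fin size → Bool
    total : (v : Fin size) → Σ (Fin size) λ w → edge v w ≡ true
    init  : Fin size
    label : Fin size → Letter n

IsPath : {n : ℕ} → (𝔗 : TS n) → (ℕ → Fin (TS.size 𝔗)) → Set
IsPath 𝔗 ρ = (ρ 0 ≡ TS.init 𝔗) × ((j : ℕ) → TS.edge 𝔗 (ρ j) (ρ (suc j)) ≡ true)

Tr : {n : ℕ} → TS n → Trace n → Set
Tr 𝔗 t = Σ (ℕ → Fin (TS.size 𝔗)) λ ρ → IsPath 𝔗 ρ × ((j : ℕ) → TS.label 𝔗 (ρ j) ≡ t j)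

data QF (n k : ℕ) : Set where
  prop  : Fin n → Fin k → QF n k
  ¬'_   : QF n k → QF n k
  _∨'_  : QF n k → QF n k → QF n k
  X'_   : QF n k → QF n k
  _U'_  : QF n k → QF n k → QF n k

-- Formulas in which k variables π_0 … π_{k-1} are already bound;
-- the next quantifier binds π_k.
data Formula (n : ℕ) : ℕ → Set where
  ∃'_ : {k : ℕ} → Formula n (suc k) → Formula n k
  ∀'_ : {k : ℕ} → Formula n (suc k) → Formula n k
  qf  : {k : ℕ} → QF n k → Formula n k

Sentence : ℕ → Set
Sentence n = Formula n 0

shift : {n k : ℕ} → ℕ → (Fin k → Trace n) → Fin k → Trace n
shift j Π i t = Π i (j + t)

satQF : {n k : ℕ} → QF n k → (Fin k → Trace n) → Set
satQF (prop a i) Π = a ∈ₗ Π i 0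
satQF (¬' ψ) Π = ¬ satQF ψ Π
satQF (ψ₁ ∨' ψ₂) Π = satQF ψ₁ Π ⊎ satQF ψ₂ Π
satQF (X' ψ) Π = satQF ψ (shift 1 Π)
satQF (ψ₁ U' ψ₂) Π =
  Σ ℕ λ j → satQF ψ₂ (shift j Π) × ((j' : ℕ) → j' < j → satQF ψ₁ (shift j' Π))

satF : {n k : ℕ} → (Trace n → Set) → Formula n k → Vec (Trace n) k → Set
satF {n} T (∃' φ) Π = Σ (Trace n) λ t → T t × satF T φ (Π ∷ʳ t)
satF T (∀' φ) Π = (t : _) → T t → satF T φ (Π ∷ʳ t)
satF T (qf ψ) Π = satQF ψ (lookup Π)

_⊨_ : {n : ℕ} → TS n → Sentence n → Set
𝔗 ⊨ φ = satF (Tr 𝔗) φ []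

-- Skolem functions.  For a formula with prefix, one function per
-- existential quantifier, taking the traces of the preceding universally
-- quantified variables (u of them, in order).

SkolemFns : {n k : ℕ} → Formula n k → ℕ → Set
SkolemFns {n} (∃' φ) u = (Vec (Trace n) u → Trace n) × SkolemFns φ u
SkolemFns (∀' φ) u = SkolemFns φ (suc u)
SkolemFns (qf ψ) u = ⊤

MapsInto : {n k u : ℕ} → (Trace n → Set) → (φ : Formula n k) → SkolemFns φ u → Set
MapsInto {u = u} T (∃' φ) (f , fs) =
  ((us : Vec _ u) → All T us → T (f us)) × MapsInto T φ fs
MapsInto T (∀' φ) fs = MapsInto T φ fs
MapsInto T (qf ψ) fs = ⊤

-- every assignment consistent with the Skolem functions satisfies ψ.
-- Π : traces of all variables so far, us : traces of universal ones so far.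
Witnesses : {n k u : ℕ} → (Trace n → Set) → (φ : Formula n k) → SkolemFns φ u →
            Vec (Trace n) k → Vec (Trace n) u → Set
Witnesses T (∃' φ) (f , fs) Π us = Witnesses T φ fs (Π ∷ʳ f us) us
Witnesses T (∀' φ) fs Π us = (t : _) → T t → Witnesses T φ fs (Π ∷ʳ t) (us ∷ʳ t)
Witnesses T (qf ψ) fs Π us = satQF ψ (lookup Π)

-- Turing machines with one-way read-only input tape, two-way work tape
-- (indexed by ℤ, blank = zero) and one-way write-only output tape.  No halting: a halting
-- machine is modelled by a looping state that writes nothing.

data Move : Set where
  L S R : Move

record TM (Σᵢ Γ : Set) : Set where
  field
    nstates : ℕ
    nwork   : ℕ
    -- (state, input symbol, work symbol) ↦
    --   (new state, advance input head?, written work symbol,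
    --    work head move, optional output symbol)
    δ : Fin (suc nstates) → Σᵢ → Fin (suc nwork) →
        Fin (suc nstates) × Bool × Fin (suc nwork) × Move × Maybe Γ

record Config {Σᵢ Γ : Set} (M : TM Σᵢ Γ) : Set where
  field
    state  : Fin (suc (TM.nstates M))
    inPos  : ℕ
    work   : ℤ → Fin (suc (TM.nwork M))
    head   : ℤ
    outPos : ℕ
    out    : ℕ → Maybe Γ

initConfig : {Σᵢ Γ : Set} (M : TM Σᵢ Γ) → Config M
initConfig M = record
  { state = Fin.zero ; inPos = 0 ; work = λ _ → Fin.zero ; head = ℤ.pos 0
  ; outPos = 0 ; out = λ _ → nothing }

moveHead : Move → ℤ → ℤ
moveHead L z = z -ℤ ℤ.pos 1
moveHead S z = z
moveHead R z = z +ℤ ℤ.pos 1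

bumpPos : {Γ : Set} → Maybe Γ → ℕ → ℕ
bumpPos (just _) p = suc p
bumpPos nothing  p = p

writeOut : {Γ : Set} → Maybe Γ → ℕ → (ℕ → Maybe Γ) → ℕ → Maybe Γ
writeOut nothing  p f i = f i
writeOut (just γ) p f i with i ≟ℕ p
... | yes _ = just γ
... | no _  = f i

step : {Σᵢ Γ : Set} (M : TM Σᵢ Γ) → (ℕ → Σᵢ) → Config M → Config M
step M w c with TM.δ M (Config.state c) (w (Config.inPos c)) (Config.work c (Config.head c))
... | (q' , adv , s , mv , o) = record
  { state  = q'
  ; inPos  = if adv then suc (Config.inPos c) else Config.inPos c
  ; work   = λ z → updW z
  ; head   = moveHead mv (Config.head c)
  ; outPos = outPos'
  ; out    = out'
  }
  where
  updW : ℤ → Fin (suc (TM.nwork M))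
  updW z with z ≟ℤ Config.head c
  ... | yes _ = s
  ... | no _  = Config.work c z
  outPos' : ℕ
  outPos' = bumpPos o (Config.outPos c)
  out' : ℕ → Maybe _
  out' = writeOut o (Config.outPos c) (Config.out c)

run : {Σᵢ Γ : Set} (M : TM Σᵢ Γ) → (ℕ → Σᵢ) → ℕ → Config M
run M w zero    = initConfig M
run M w (suc t) = step M w (run M w t)

Computes : {Σᵢ Γ : Set} (M : TM Σᵢ Γ) → (ℕ → Σᵢ) → (ℕ → Γ) → Set
Computes M w y = (i : ℕ) → Σ ℕ λ t → Config.out (run M w t) i ≡ just (y i)

merge : {n u : ℕ} → Vec (Trace n) u → ℕ → Vec (Letter n) u
merge us j = map (λ t → t j) us

-- f : Tr^u → Tr computable (as a partial function with domain the merges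
-- of u-tuples of traces in T)
ComputableOn : {n u : ℕ} → (Trace n → Set) → (Vec (Trace n) u → Trace n) → Set
ComputableOn {n} {u} T f =
  Σ (TM (Vec (Letter n) u) (Letter n)) λ M →
    (us : Vec (Trace n) u) → All T us → Computes M (merge us) (f us)

AllComputable : {n k u : ℕ} → (Trace n → Set) → (φ : Formula n k) → SkolemFns φ u → Set
AllComputable T (∃' φ) (f , fs) = ComputableOn T f × AllComputable T φ fs
AllComputable T (∀' φ) fs = AllComputable T φ fs
AllComputable T (qf ψ) fs = ⊤

WitnessedByComputableSkolem : {n : ℕ} → TS n → Sentence n → Set
WitnessedByComputableSkolem 𝔗 φ =
  Σ (SkolemFns φ 0) λ fs →
    MapsInto (Tr 𝔗) φ fs × Witnesses (Tr 𝔗) φ fs [] [] × AllComputable (Tr 𝔗) φ fs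

-- Take AP = {a}, the transition system whose traces are all words starting
-- with ∅, and φ = ∀π. ∃π'. (X a_π' ↔ F a_π).  The sentence holds: answer
-- π' = ∅{a}∅∅… when a eventually occurs on π and π' = ∅^ω otherwise.  But
-- the second letter of any Skolem witness f(π) decides whether π ever
-- contains a.  A machine writes each output cell after finitely many steps
-- and never overwrites it, so the written letter depends only on a finite
-- input prefix: on ∅^ω the cell is written at some time T, and on the
-- input that agrees with ∅^ω up to T and has a at position T + 1 the same
-- letter is written, although the correct answer differs.
module Submission where

open import Defs
open import Level using (0ℓ)
open import Axiom.ExcludedMiddle using (ExcludedMiddle)
open import Relation.Binary.PropositionalEquality
open import Data.Nat
open import Data.Nat.Properties
open import Data.Bool using (true; false; if_then_else_)
open import Data.Bool.Properties using () renaming (_≟_ to _≟ᵇ_)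
open import Data.Maybe using (just; nothing)
open import Data.Maybe.Properties using (just-injective)
open import Data.Product using (Σ; _×_; _,_; proj₁; proj₂; ∃-syntax)
open import Data.Sum using (inj₁; inj₂; swap)
open import Data.Unit using (tt)
open import Data.Fin using (Fin; zero; suc)
open import Data.Vec using ([]; _∷_; lookup)
open import Data.Vec.Relation.Unary.All using ([]; _∷_)
open import Relation.Nullary
open import Relation.Nullary.Decidable using (dec-true; dec-false; toSum)

module _ {Σᵢ Γ : Set} (M : TM Σᵢ Γ) where

  open Config

  step-input-cong : ∀ (w w' : ℕ → Σᵢ) c → w (inPos c) ≡ w' (inPos c) →
                    step M w c ≡ step M w' c
  step-input-cong w w' c eq = cong (λ x → step M (λ _ → x) c) eq

  inPos-step-≤ : ∀ (w : ℕ → Σᵢ) c → inPos (step M w c) ≤ suc (inPos c)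
  inPos-step-≤ w c with TM.δ M (state c) (w (inPos c)) (work c (head c))
  ... | (_ , true  , _) = ≤-refl
  ... | (_ , false , _) = n≤1+n _

  inPos-run-≤ : ∀ (w : ℕ → Σᵢ) s → inPos (run M w s) ≤ s
  inPos-run-≤ w zero    = z≤n
  inPos-run-≤ w (suc s) = ≤-trans (inPos-step-≤ w (run M w s)) (s≤s (inPos-run-≤ w s))

  -- The input head advances at most one cell per step, so s steps read only w 0 … w (s ∸ 1).
  run-input-cong : ∀ (w w' : ℕ → Σᵢ) s → (∀ j → j < s → w j ≡ w' j) →
                   run M w s ≡ run M w' s
  run-input-cong w w' zero    agree = refl
  run-input-cong w w' (suc s) agree
    rewrite run-input-cong w w' s (λ j j<s → agree j (m<n⇒m<1+n j<s)) =
    step-input-cong w w' (run M w' s) (agree _ (s≤s (inPos-run-≤ w' s)))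

  BlankFromOutPos : Config M → Set
  BlankFromOutPos c = ∀ i → outPos c ≤ i → out c i ≡ nothing

  blankFromOutPos-step : ∀ (w : ℕ → Σᵢ) c → BlankFromOutPos c → BlankFromOutPos (step M w c)
  blankFromOutPos-step w c blank with TM.δ M (state c) (w (inPos c)) (work c (head c))
  ... | (_ , _ , _ , _ , nothing) = blank
  ... | (_ , _ , _ , _ , just γ)  = blank′
    where
    blank′ : ∀ i → suc (outPos c) ≤ i → writeOut (just γ) (outPos c) (out c) i ≡ nothing
    blank′ i p<i with i ≟ outPos c
    ... | yes refl = contradiction p<i (n≮n i)
    ... | no _     = blank i (<⇒≤ p<i)

  blankFromOutPos-run : ∀ (w : ℕ → Σᵢ) s → BlankFromOutPos (run M w s)
  blankFromOutPos-run w zero    i _ = refl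
  blankFromOutPos-run w (suc s) = blankFromOutPos-step w (run M w s) (blankFromOutPos-run w s)

  -- A machine only writes at the blank cell outPos, so written cells are never overwritten.
  out-stable-step : ∀ (w : ℕ → Σᵢ) c → BlankFromOutPos c → ∀ i {x} →
                    out c i ≡ just x → out (step M w c) i ≡ just x
  out-stable-step w c blank i e with TM.δ M (state c) (w (inPos c)) (work c (head c))
  ... | (_ , _ , _ , _ , nothing) = e
  ... | (_ , _ , _ , _ , just γ) with i ≟ outPos c
  ... | yes refl = contradiction (trans (sym e) (blank i ≤-refl)) λ ()
  ... | no _     = e

  out-stable : ∀ (w : ℕ → Σᵢ) {s s'} → s ≤′ s' → ∀ i {x} →
               out (run M w s) i ≡ just x → out (run M w s') i ≡ just x
  out-stable w ≤′-refl i e = e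
  out-stable w {s' = suc s'} (≤′-step s≤s') i e =
    out-stable-step w (run M w s') (blankFromOutPos-run w s') i (out-stable w s≤s' i e)

  out-written-unique : ∀ (w : ℕ → Σᵢ) s s' i {x x'} →
                       out (run M w s) i ≡ just x → out (run M w s') i ≡ just x' → x ≡ x'
  out-written-unique w s s' i e e' =
    just-injective (trans (sym (toMax (m≤m⊔n s s') e)) (toMax (m≤n⊔m s s') e'))
    where
    toMax : ∀ {t y} → t ≤ s ⊔ s' →
            out (run M w t) i ≡ just y → out (run M w (s ⊔ s')) i ≡ just y
    toMax t≤ = out-stable w (≤⇒≤′ t≤) i

  computes-continuous : ∀ {w w' : ℕ → Σᵢ} {y y' : ℕ → Γ} →
                        (c : Computes M w y) → Computes M w' y' → ∀ i →
                        (∀ j → j < proj₁ (c i) → w j ≡ w' j) → y i ≡ y' i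
  computes-continuous {w} {w'} c c' i agree =
    out-written-unique w' (proj₁ (c i)) (proj₁ (c' i)) i
      (trans (cong (λ d → Config.out d i) (sym (run-input-cong w w' _ agree))) (proj₂ (c i)))
      (proj₂ (c' i))

module _ {n k : ℕ} where

  _∧'_ : QF n k → QF n k → QF n k
  φ ∧' ψ = ¬' ((¬' φ) ∨' (¬' ψ))

  _⇔'_ : QF n k → QF n k → QF n k
  φ ⇔' ψ = ((¬' φ) ∨' ψ) ∧' (φ ∨' (¬' ψ))

  -- ¬ψ ∨ ψ serves as "true", QF having no constants.
  F'_ : QF n k → QF n k
  F' ψ = ((¬' ψ) ∨' ψ) U' ψ

  ⇔'-intro : ∀ {φ ψ Π} → (satQF φ Π → satQF ψ Π) → (satQF ψ Π → satQF φ Π) →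
             satQF (φ ⇔' ψ) Π
  ⇔'-intro φ→ψ ψ→φ (inj₁ ¬l) = ¬l (inj₁ λ φ′ → ¬l (inj₂ (φ→ψ φ′)))
  ⇔'-intro φ→ψ ψ→φ (inj₂ ¬r) = ¬r (inj₂ λ ψ′ → ¬r (inj₁ (ψ→φ ψ′)))

  ⇔'-from : ∀ {φ ψ Π} → satQF (φ ⇔' ψ) Π → Dec (satQF φ Π) → satQF ψ Π → satQF φ Π
  ⇔'-from φ⇔ψ (yes φ′) ψ′ = φ′
  ⇔'-from φ⇔ψ (no ¬φ)  ψ′ =
    contradiction (inj₂ λ { (inj₁ φ′) → ¬φ φ′ ; (inj₂ ¬ψ) → ¬ψ ψ′ }) φ⇔ψ

  ⇔'-contra : ∀ {φ ψ Π} → satQF (φ ⇔' ψ) Π → ¬ satQF ψ Π → ¬ satQF φ Π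
  ⇔'-contra φ⇔ψ ¬ψ φ′ = φ⇔ψ (inj₁ λ { (inj₁ ¬φ) → ¬φ φ′ ; (inj₂ ψ′) → ¬ψ ψ′ })

  F'-sound : ∀ {ψ Π} → satQF (F' ψ) Π → ∃[ j ] satQF ψ (shift j Π)
  F'-sound (j , ψ′ , _) = j , ψ′

  F'-complete : ∀ {ψ Π} → (∀ j → Dec (satQF ψ (shift j Π))) →
                ∃[ j ] satQF ψ (shift j Π) → satQF (F' ψ) Π
  F'-complete ψ? (j , ψ′) = j , ψ′ , λ j' _ → swap (toSum (ψ? j'))

Eventually : {n : ℕ} → Fin n → Trace n → Set
Eventually a t = ∃[ j ] a ∈ₗ t j

module _ {n k : ℕ} (a : Fin n) (i : Fin k) where

  private
    at : ∀ (Π : Fin k → Trace n) j → lookup (shift j Π i 0) a ≡ lookup (Π i j) a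
    at Π j = cong (λ m → lookup (Π i m) a) (+-identityʳ j)

  F'-prop-sound : ∀ {Π} → satQF (F' (prop a i)) Π → Eventually a (Π i)
  F'-prop-sound {Π} F =
    let j , a∈ = F'-sound {ψ = prop a i} {Π = Π} F in j , trans (sym (at Π j)) a∈

  F'-prop-complete : ∀ {Π} → Eventually a (Π i) → satQF (F' (prop a i)) Π
  F'-prop-complete {Π} (j , a∈) =
    F'-complete {ψ = prop a i} {Π = Π} (λ j' → lookup (shift j' Π i 0) a ≟ᵇ true)
      (j , trans (at Π j) a∈)

∅ : Letter 1
∅ = false ∷ []

a : Fin 1
a = zero

∅-initial : TS 1
∅-initial = record
  { size = 2 ; edge = λ _ _ → true ; total = λ v → v , refl ; init = zero ; label = label }
  where
  label : Fin 2 → Letter 1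
  label zero    = ∅
  label (suc _) = true ∷ []

Tr-∅-initial : ∀ {t} → t 0 ≡ ∅ → Tr ∅-initial t
Tr-∅-initial {t} t0≡∅ =
  (λ j → stateOf (t j)) , (cong stateOf t0≡∅ , λ _ → refl) , λ j → label-stateOf (t j)
  where
  stateOf : Letter 1 → Fin 2
  stateOf (b ∷ []) = if b then suc zero else zero
  label-stateOf : ∀ ℓ → TS.label ∅-initial (stateOf ℓ) ≡ ℓ
  label-stateOf (true  ∷ []) = refl
  label-stateOf (false ∷ []) = refl

silent : Trace 1
silent _ = ∅

signalAt : ℕ → Trace 1
signalAt k j = does (j ≟ k) ∷ []

¬eventually-silent : ¬ Eventually a silent
¬eventually-silent (_ , ())

eventually-signalAt : ∀ k → Eventually a (signalAt k)
eventually-signalAt k = k , dec-true (k ≟ k) refl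

signalAt-silent-below : ∀ {k j} → j < k → signalAt k j ≡ silent j
signalAt-silent-below {k} {j} j<k = cong (_∷ []) (dec-false (j ≟ k) (<⇒≢ j<k))

π π' : Fin 2
π  = zero
π' = suc zero

ψ : QF 1 2
ψ = (X' (prop a π')) ⇔' (F' (prop a π))

φ : Sentence 1
φ = ∀' (∃' (qf ψ))

ψ-intro : ∀ Π → (a ∈ₗ Π π' 1 → Eventually a (Π π)) →
          (Eventually a (Π π) → a ∈ₗ Π π' 1) → satQF ψ Π
ψ-intro Π X→F F→X =
  ⇔'-intro {φ = X' (prop a π')} {F' (prop a π)} {Π}
    (λ X → F'-prop-complete a π {Π} (X→F X)) (λ F → F→X (F'-prop-sound a π {Π} F))

∅-initial⊨φ : ExcludedMiddle 0ℓ → ∅-initial ⊨ φ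
∅-initial⊨φ em t _ with em {Eventually a t}
... | yes ev =
  signalAt 1 , Tr-∅-initial refl , ψ-intro (lookup (t ∷ signalAt 1 ∷ [])) (λ _ → ev) (λ _ → refl)
... | no ¬ev =
  silent , Tr-∅-initial refl , ψ-intro (lookup (t ∷ silent ∷ [])) (λ ()) (λ ev → contradiction ev ¬ev)

ψ-eventually : ∀ Π → satQF ψ Π → Eventually a (Π π) → a ∈ₗ Π π' 1
ψ-eventually Π ψ′ ev =
  ⇔'-from {φ = X' (prop a π')} {F' (prop a π)} {Π} ψ′ (lookup (Π π' 1) a ≟ᵇ true)
    (F'-prop-complete a π {Π} ev)

ψ-¬eventually : ∀ Π → satQF ψ Π → ¬ Eventually a (Π π) → ¬ a ∈ₗ Π π' 1
ψ-¬eventually Π ψ′ ¬ev =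
  ⇔'-contra {φ = X' (prop a π')} {F' (prop a π)} {Π} ψ′ (λ F → ¬ev (F'-prop-sound a π {Π} F))

-- T is the time at which M writes the second letter of f(silent); the inputs
-- silent and signalAt (suc T) agree before T.
¬computable : ¬ WitnessedByComputableSkolem ∅-initial φ
¬computable ((f , tt) , _ , witnesses , (M , computes) , tt) =
  ψ-¬eventually (assignment silent) (witness silent refl) ¬eventually-silent
    (subst (a ∈ₗ_) (sym same-answer)
      (ψ-eventually (assignment signal) (witness signal refl) (eventually-signalAt (suc T))))
  where
  assignment : Trace 1 → Fin 2 → Trace 1
  assignment t = lookup (t ∷ f (t ∷ []) ∷ [])
  witness : ∀ t → t 0 ≡ ∅ → satQF ψ (assignment t)
  witness t t0≡∅ = witnesses t (Tr-∅-initial t0≡∅)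
  computes-on : ∀ t → t 0 ≡ ∅ → Computes M (merge (t ∷ [])) (f (t ∷ []))
  computes-on t t0≡∅ = computes (t ∷ []) (Tr-∅-initial t0≡∅ ∷ [])
  T : ℕ
  T = proj₁ (computes-on silent refl 1)
  signal : Trace 1
  signal = signalAt (suc T)
  same-answer : f (silent ∷ []) 1 ≡ f (signal ∷ []) 1
  same-answer = computes-continuous M (computes-on silent refl) (computes-on signal refl) 1
    λ j j<T → cong (_∷ []) (sym (signalAt-silent-below (m<n⇒m<1+n j<T)))

theorem4p1 : ExcludedMiddle 0ℓ →
    Σ ℕ λ n → Σ (Sentence n) λ φ → Σ (TS n) λ 𝔗 →
    (𝔗 ⊨ φ) × ¬ WitnessedByComputableSkolem 𝔗 φ
theorem4p1 em = 1 , φ , ∅-initial , ∅-initial⊨φ em , ¬computable
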